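{- For all integers $k\geq 1$ and $p\geq 3$, $\mathrm{cat}(Gr(p,k))\geq kp$.
   Context: Cat Herding is a two-player game on a finite simple graph $G$ between a cat and a herder. First the cat places its token on a starting vertex. Then the players alternate, the herder moving first: on the herder's turn it deletes one edge of the current graph (a "cut"); on the cat's turn the cat must move its token along a path of the current graph to a different vertex. The game ends when the cat's current vertex has no incident edges. The score is the total number of edges deleted; the herder minimizes and the cat maximizes it. For $v\in V(G)$, $\mathrm{cat}(G,v)$ is the optimal-play score when the cat starts at $v$, and $\mathrm{cat}(G)=\max_{v\in V(G)}\mathrm{cat}(G,v)$. For integers $p,k\geq 1$, $Gr(p,k)$ is obtained from the $p\times p$ grid graph $P_p\square P_p$ by replacing every edge with $k$ parallel edges between the same endpoints and then subdividing every one of these edges by one new vertex; equivalently, each grid edge $uv$ is replaced by $k$ internally disjoint paths $u\,w\,v$ of length $2$ with new middle vertices $w$. -}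

module Defs where

open import Data.Nat using (ℕ; zero; suc; pred)
open import Data.Fin using (Fin; inject₁) renaming (suc to fsuc)
open import Data.List using (List; []; _∷_; concatMap; allFin)
open import Data.List.Membership.Propositional using (_∈_)
open import Data.List.Relation.Unary.Any using (_─_)
open import Data.Product using (_×_; _,_; ∃-syntax)
open import Data.Sum using (_⊎_)
open import Relation.Binary.PropositionalEquality using (_≡_; _≢_)

-- An edge (a , b) is undirected.  The "current graph" of the game is
-- the original graph with some edges deleted, i.e. a sub-list of edges.

Edges : Set → Set
Edges V = List (V × V)

Incident : {V : Set} → Edges V → V → Set
Incident {V} E v = ∃[ e ] (e ∈ E × (Data.Product.proj₁ e ≡ v ⊎ Data.Product.proj₂ e ≡ v))
  where import Data.Product

data Reach {V : Set} (E : Edges V) : V → V → Set where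
  here : ∀ {v} → Reach E v v
  fwd  : ∀ {u v w} → (u , v) ∈ E → Reach E v w → Reach E u w
  bwd  : ∀ {u v w} → (v , u) ∈ E → Reach E v w → Reach E u w

-- Cat Herding.  A position is (current edge list E, cat vertex v, whose
-- turn).  The game ends as soon as the cat's vertex has no incident edge.
--
-- CatForcesH E v s : herder to move, cat at v; the cat can guarantee
--                    that at least s further edges will be deleted.
-- CatForcesC E v s : cat to move, cat at v; same meaning.
--
-- Hence  cat(G,v) ≥ s  iff  CatForcesH (edges of G) v s  (the herder
-- moves first after the cat places its token).

mutual
  data CatForcesH {V : Set} (E : Edges V) (v : V) : ℕ → Set where
    h-zero : CatForcesH E v 0
    h-suc  : ∀ {s} → Incident E v →
             (∀ {e} (i : e ∈ E) → CatForcesC (E ─ i) v s) →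
             CatForcesH E v (suc s)

  data CatForcesC {V : Set} (E : Edges V) (v : V) : ℕ → Set where
    c-zero : CatForcesC E v 0
    c-move : ∀ {s} (w : V) → w ≢ v → Reach E v w →
             CatForcesH E w s → CatForcesC E v s

CatAtLeast : (V : Set) → Edges V → ℕ → Set
CatAtLeast V E s = ∃[ v ] CatForcesH {V} E v s

-- Grid vertices: grid i j  (row i, column j), i j : Fin p.
-- Horizontal grid edge between grid i (left j) and grid i (right j),
--   j : Fin (p - 1), subdivided k times: middle vertices hmid i j c.
-- Vertical grid edge between grid (left i) j and grid (right i) j,
--   i : Fin (p - 1): middle vertices vmid i j c.

left : ∀ {p} → Fin (pred p) → Fin p
left {suc q} j = inject₁ j

right : ∀ {p} → Fin (pred p) → Fin p
right {suc q} j = fsuc j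

data GrV (p k : ℕ) : Set where
  grid : Fin p → Fin p → GrV p k
  hmid : Fin p → Fin (pred p) → Fin k → GrV p k
  vmid : Fin (pred p) → Fin p → Fin k → GrV p k

GrE : (p k : ℕ) → Edges (GrV p k)
GrE p k =
  concatMap (λ i → concatMap (λ j → concatMap (λ c →
      (grid i (left j) , hmid i j c) ∷ (hmid i j c , grid i (right j)) ∷ [])
    (allFin k)) (allFin (pred p))) (allFin p)
  Data.List.++
  concatMap (λ i → concatMap (λ j → concatMap (λ c →
      (grid (left i) j , vmid i j c) ∷ (vmid i j c , grid (right i) j) ∷ [])
    (allFin k)) (allFin p)) (allFin (pred p))
  where import Data.List

{-# OPTIONS --safe #-}

-- Call a row or column of the grid intact if each of its p − 1 segments still has one of its k
-- parallel paths, and let the cat always sit at a grid vertex whose row and column are both intact.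
-- A line is broken only when, in one of its segments, all k paths have lost an edge; since distinct
-- paths share no edge, p broken lines cost at least kp cuts.  A cut breaks at most one of the cat's two
-- lines, and along a surviving line the cat reaches another such vertex unless p lines are broken.
-- Hence the cat moves as long as fewer than kp edges are cut.  The argument works for every p ≥ 2.

module Submission where

open import Defs
open import Data.Nat using (ℕ; _*_; _≤_)
open import Data.Nat using (zero; suc; _+_; _<_; s≤s; z<s)
import Data.Nat.Properties as ℕ
open import Data.Fin using (Fin; zero; suc; inject₁; fromℕ<)
open import Data.Fin.Properties using (_≟_; any?; all?; ¬∀⟶∃¬; injective⇒≤; *↔×; punchInᵢ≢i)
open import Data.List using (List; []; _∷_; _++_; concatMap; allFin; length)
open import Data.List.Membership.Propositional using (_∈_; _∉_; lose)
open import Data.List.Membership.Propositional.Properties using (∈-concatMap⁺; ∈-allFin; ∈-++⁺ˡ; ∈-++⁺ʳ; ∈-++⁻)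
open import Data.List.Membership.Setoid.Properties using (index-injective)
open import Data.List.Relation.Binary.Subset.Propositional using (_⊆_)
open import Data.List.Relation.Unary.Any using (here; there; _─_; index)
open import Data.Product using (Σ; _×_; _,_; ∃-syntax; ∃₂; proj₁; proj₂)
import Data.Product.Properties as Product
open import Data.Sum using (_⊎_; inj₁; inj₂)
open import Data.Empty using (⊥-elim)
open import Function using (_∘_)
open import Function.Bundles using (Injection)
open import Function.Definitions using (Injective)
open import Function.Properties.Inverse using (Inverse⇒Injection)
open import Relation.Binary.Definitions using (DecidableEquality)
open import Relation.Binary.PropositionalEquality using (_≡_; _≢_; refl; sym; cong; subst; setoid)
open import Relation.Nullary using (¬_; Dec; yes; no)
open import Relation.Nullary.Decidable using (map′; _×-dec_; ¬?)

×-injective⇒≤ : ∀ {m n o} {f : Fin m × Fin n → Fin o} → Injective _≡_ _≡_ f → m * n ≤ o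
×-injective⇒≤ {m} f-inj = injective⇒≤ (Injection.injective (Inverse⇒Injection (*↔× {m})) ∘ f-inj)

∈-concatMap-allFin : ∀ {B : Set} {n} (f : Fin n → List B) {y} i → y ∈ f i → y ∈ concatMap f (allFin n)
∈-concatMap-allFin f i y∈fi = ∈-concatMap⁺ f (lose (∈-allFin i) y∈fi)

∈⇒≡⊎∈─ : ∀ {A : Set} {xs : List A} {x y} (y∈xs : y ∈ xs) → x ∈ xs → x ≡ y ⊎ x ∈ (xs ─ y∈xs)
∈⇒≡⊎∈─ (here refl) (here x≡y)   = inj₁ x≡y
∈⇒≡⊎∈─ (here refl) (there x∈xs) = inj₂ x∈xs
∈⇒≡⊎∈─ (there _)   (here x≡z)   = inj₂ (here x≡z)
∈⇒≡⊎∈─ (there y∈xs) (there x∈xs) with ∈⇒≡⊎∈─ y∈xs x∈xs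
... | inj₁ x≡y     = inj₁ x≡y
... | inj₂ x∈xs─y = inj₂ (there x∈xs─y)

⊆-─ : ∀ {A : Set} {xs ys : List A} {y} → xs ⊆ ys → (y∈ys : y ∈ ys) → y ∉ xs → xs ⊆ (ys ─ y∈ys)
⊆-─ xs⊆ys y∈ys y∉xs x∈xs with ∈⇒≡⊎∈─ y∈ys (xs⊆ys x∈xs)
... | inj₁ refl    = ⊥-elim (y∉xs x∈xs)
... | inj₂ x∈ys─y = x∈ys─y

⊈ˡ⇒∈ʳ : ∀ {A : Set} {xs ys zs : List A} → xs ⊆ ys ++ zs → ¬ xs ⊆ ys → ∃[ x ] (x ∈ xs × x ∈ zs)
⊈ˡ⇒∈ʳ {xs = []}     _ []⊈ys = ⊥-elim ([]⊈ys λ ())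
⊈ˡ⇒∈ʳ {xs = x ∷ xs} {ys} x∷xs⊆ys++zs x∷xs⊈ys with ∈-++⁻ ys (x∷xs⊆ys++zs (here refl))
... | inj₂ x∈zs = x , here refl , x∈zs
... | inj₁ x∈ys with ⊈ˡ⇒∈ʳ (x∷xs⊆ys++zs ∘ there) xs⊈ys
  where
  xs⊈ys : ¬ xs ⊆ ys
  xs⊈ys xs⊆ys = x∷xs⊈ys λ { (here refl) → x∈ys ; (there x′∈xs) → xs⊆ys x′∈xs }
...   | z , z∈xs , z∈zs = z , there z∈xs , z∈zs

module _ {V : Set} {E : Edges V} where

  reach-trans : ∀ {u v w} → Reach E u v → Reach E v w → Reach E u w
  reach-trans here        r = r
  reach-trans (fwd uv r) r′ = fwd uv (reach-trans r r′)
  reach-trans (bwd vu r) r′ = bwd vu (reach-trans r r′)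

  reach-sym : ∀ {u v} → Reach E u v → Reach E v u
  reach-sym here       = here
  reach-sym (fwd uv r) = reach-trans (reach-sym r) (bwd uv here)
  reach-sym (bwd vu r) = reach-trans (reach-sym r) (fwd vu here)

  reach-from-head : ∀ {m} (f : Fin (suc m) → V) → (∀ a → Reach E (f (inject₁ a)) (f (suc a))) →
                    ∀ t → Reach E (f zero) (f t)
  reach-from-head f step zero = here
  reach-from-head {suc m} f step (suc t) = reach-trans (step zero) (reach-from-head (f ∘ suc) (step ∘ suc) t)

  reach-along : ∀ {m} (f : Fin (suc m) → V) → (∀ a → Reach E (f (inject₁ a)) (f (suc a))) →
                ∀ t t′ → Reach E (f t) (f t′)
  reach-along f step t t′ = reach-trans (reach-sym (reach-from-head f step t)) (reach-from-head f step t′)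

module Herding (q k : ℕ) where

  p : ℕ
  p = 2 + q

  V : Set
  V = GrV p k

  G : Edges V
  G = GrE p k

  _≟ᵛ_ : DecidableEquality V
  grid i j ≟ᵛ grid i′ j′ =
    map′ (λ { (refl , refl) → refl }) (λ { refl → refl , refl }) (i ≟ i′ ×-dec j ≟ j′)
  hmid i a c ≟ᵛ hmid i′ a′ c′ =
    map′ (λ { (refl , refl , refl) → refl }) (λ { refl → refl , refl , refl })
         (i ≟ i′ ×-dec a ≟ a′ ×-dec c ≟ c′)
  vmid a j c ≟ᵛ vmid a′ j′ c′ =
    map′ (λ { (refl , refl , refl) → refl }) (λ { refl → refl , refl , refl })
         (a ≟ a′ ×-dec j ≟ j′ ×-dec c ≟ c′)
  grid _ _   ≟ᵛ hmid _ _ _ = no λ ()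
  grid _ _   ≟ᵛ vmid _ _ _ = no λ ()
  hmid _ _ _ ≟ᵛ grid _ _   = no λ ()
  hmid _ _ _ ≟ᵛ vmid _ _ _ = no λ ()
  vmid _ _ _ ≟ᵛ grid _ _   = no λ ()
  vmid _ _ _ ≟ᵛ hmid _ _ _ = no λ ()

  open import Data.List.Membership.DecPropositional (Product.≡-dec _≟ᵛ_ _≟ᵛ_) using (_∈?_)
  open import Data.List.Relation.Binary.Subset.DecPropositional (Product.≡-dec _≟ᵛ_ _≟ᵛ_) using (_⊆?_)

  -- A line is a row or a column of the grid.  Its a-th segment joins its points a and a + 1
  -- by k paths of length two, the c-th of them through the vertex  middle ℓ a c.
  data Line : Set where
    row col : Fin p → Line

  point : Line → Fin p → V
  point (row i) t = grid i t
  point (col j) t = grid t j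

  middle : Line → Fin (suc q) → Fin k → V
  middle (row i) a c = hmid i a c
  middle (col j) a c = vmid a j c

  path : Line → Fin (suc q) → Fin k → Edges V
  path ℓ a c = (point ℓ (inject₁ a) , middle ℓ a c) ∷ (middle ℓ a c , point ℓ (suc a)) ∷ []

  segment : Line → Fin (suc q) → Edges V
  segment ℓ a = concatMap (path ℓ a) (allFin k)

  lineEdges : Line → Edges V
  lineEdges ℓ = concatMap (segment ℓ) (allFin (suc q))

  path⊆G : ∀ ℓ a c → path ℓ a c ⊆ G
  path⊆G (row i) a c =
    ∈-++⁺ˡ ∘ ∈-concatMap-allFin (lineEdges ∘ row) i
           ∘ ∈-concatMap-allFin (segment (row i)) a
           ∘ ∈-concatMap-allFin (path (row i) a) c
  path⊆G (col j) a c =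
    ∈-++⁺ʳ (concatMap (lineEdges ∘ row) (allFin p))
      ∘ ∈-concatMap-allFin (λ a → concatMap (λ j → segment (col j) a) (allFin p)) a
      ∘ ∈-concatMap-allFin (λ j → segment (col j) a) j
      ∘ ∈-concatMap-allFin (path (col j) a) c

  perp : Line → Fin p → Line
  perp (row _) t = col t
  perp (col _) t = row t

  position : Line → Fin p
  position (row i) = i
  position (col j) = j

  point-perp : ∀ ℓ t → point (perp ℓ t) (position ℓ) ≡ point ℓ t
  point-perp (row _) _ = refl
  point-perp (col _) _ = refl

  point-injective : ∀ ℓ {t t′} → point ℓ t ≡ point ℓ t′ → t ≡ t′
  point-injective (row _) refl = refl
  point-injective (col _) refl = refl

  perp-injective : ∀ ℓ {t t′} → perp ℓ t ≡ perp ℓ t′ → t ≡ t′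
  perp-injective (row _) refl = refl
  perp-injective (col _) refl = refl

  perp≢ : ∀ ℓ t → perp ℓ t ≢ ℓ
  perp≢ (row _) _ ()
  perp≢ (col _) _ ()

  perp≢perp∘perp : ∀ ℓ t u n → perp ℓ u ≢ perp (perp ℓ t) n
  perp≢perp∘perp (row _) _ _ _ ()
  perp≢perp∘perp (col _) _ _ _ ()

  point≢middle : ∀ ℓ ℓ′ t a c → point ℓ t ≢ middle ℓ′ a c
  point≢middle (row _) (row _) _ _ _ ()
  point≢middle (row _) (col _) _ _ _ ()
  point≢middle (col _) (row _) _ _ _ ()
  point≢middle (col _) (col _) _ _ _ ()

  middle-injective : ∀ ℓ ℓ′ {a a′ c c′} → middle ℓ a c ≡ middle ℓ′ a′ c′ →
                     (ℓ , a , c) ≡ (ℓ′ , a′ , c′)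
  middle-injective (row _) (row _) refl = refl
  middle-injective (col _) (col _) refl = refl
  middle-injective (row _) (col _) ()
  middle-injective (col _) (row _) ()

  paths-disjoint : ∀ {ℓ ℓ′ a a′ c c′ x} → x ∈ path ℓ a c → x ∈ path ℓ′ a′ c′ →
                   (ℓ , a , c) ≡ (ℓ′ , a′ , c′)
  paths-disjoint {ℓ} {ℓ′} (here refl)         (here eq)         = middle-injective ℓ ℓ′ (cong proj₂ eq)
  paths-disjoint {ℓ} {ℓ′} (there (here refl)) (there (here eq)) = middle-injective ℓ ℓ′ (cong proj₁ eq)
  paths-disjoint {ℓ} {ℓ′} (here refl)         (there (here eq)) =
    ⊥-elim (point≢middle ℓ ℓ′ _ _ _ (cong proj₁ eq))
  paths-disjoint {ℓ} {ℓ′} (there (here refl)) (here eq)         =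
    ⊥-elim (point≢middle ℓ′ ℓ _ _ _ (sym (cong proj₁ eq)))

  private
    variable
      E F : Edges V
      e : V × V
      ℓ ℓ′ ℓ* : Line
      t t′ : Fin p
      a : Fin (suc q)

  Passable : Edges V → Line → Fin (suc q) → Set
  Passable E ℓ a = ∃[ c ] path ℓ a c ⊆ E

  Intact : Edges V → Line → Set
  Intact E ℓ = ∀ a → Passable E ℓ a

  Broken : Edges V → Line → Set
  Broken E ℓ = ¬ Intact E ℓ

  passable? : ∀ E ℓ a → Dec (Passable E ℓ a)
  passable? E ℓ a = any? λ c → path ℓ a c ⊆? E

  intact? : ∀ E ℓ → Dec (Intact E ℓ)
  intact? E ℓ = all? (passable? E ℓ)

  impassable-segment : Broken E ℓ → ∃[ a ] ¬ Passable E ℓ a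
  impassable-segment {E} {ℓ} = ¬∀⟶∃¬ _ (Passable E ℓ) (passable? E ℓ)

  intact-reach : Intact E ℓ → ∀ t t′ → Reach E (point ℓ t) (point ℓ t′)
  intact-reach {E} {ℓ} intact = reach-along (point ℓ) cross
    where
    cross : ∀ a → Reach E (point ℓ (inject₁ a)) (point ℓ (suc a))
    cross a = let _ , path⊆E = intact a in fwd (path⊆E (here refl)) (fwd (path⊆E (there (here refl))) here)

  intact-incident : Intact E ℓ → ∀ t → Incident E (point ℓ t)
  intact-incident intact zero    = let _ , path⊆E = intact zero in _ , path⊆E (here refl) , inj₁ refl
  intact-incident intact (suc a) = let _ , path⊆E = intact a in _ , path⊆E (there (here refl)) , inj₂ refl

  -- F is the list of edges cut so far.
  Covering : Edges V → Edges V → Set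
  Covering E F = G ⊆ E ++ F

  covering-─ : Covering E F → (e∈E : e ∈ E) → Covering (E ─ e∈E) (e ∷ F)
  covering-─ {E} cov e∈E x∈G with ∈-++⁻ E (cov x∈G)
  ... | inj₂ x∈F = ∈-++⁺ʳ (E ─ e∈E) (there x∈F)
  ... | inj₁ x∈E with ∈⇒≡⊎∈─ e∈E x∈E
  ...   | inj₁ refl    = ∈-++⁺ʳ (E ─ e∈E) (here refl)
  ...   | inj₂ x∈E─e = ∈-++⁺ˡ x∈E─e

  recorded-cut : Covering E F → ¬ Passable E ℓ a → ∀ c → ∃[ x ] (x ∈ path ℓ a c × x ∈ F)
  recorded-cut cov impassable c = ⊈ˡ⇒∈ʳ (cov ∘ path⊆G _ _ c) (λ path⊆E → impassable (c , path⊆E))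

  broken-lines-cost : ∀ {m} → Covering E F → (L : Fin m → Line) → Injective _≡_ _≡_ L →
                      (∀ u → Broken E (L u)) → m * k ≤ length F
  broken-lines-cost {E} {F} {m} cov L L-injective broken = ×-injective⇒≤ cut-index-injective
    where
    cut : ∀ u c → ∃[ x ] (x ∈ path (L u) (proj₁ (impassable-segment (broken u))) c × x ∈ F)
    cut u c = recorded-cut cov (proj₂ (impassable-segment (broken u))) c

    cut-index : Fin m × Fin k → Fin (length F)
    cut-index (u , c) = index (proj₂ (proj₂ (cut u c)))

    cut-index-injective : Injective _≡_ _≡_ cut-index
    cut-index-injective {u , c} {u′ , c′} same-index =
      Product.×-≡,≡→≡ (L-injective (cong proj₁ same-path) , cong (proj₂ ∘ proj₂) same-path)
      where
      same-edge = index-injective (setoid _) (proj₂ (proj₂ (cut u c))) (proj₂ (proj₂ (cut u′ c′))) same-index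
      same-path = paths-disjoint (proj₁ (proj₂ (cut u c)))
                                 (subst (_∈ _) (sym same-edge) (proj₁ (proj₂ (cut u′ c′))))

  Blocked : Edges V → Set
  Blocked E = Σ (Fin p → Line) λ L → Injective _≡_ _≡_ L × ∀ u → Broken E (L u)

  not-blocked : Covering E F → length F < p * k → ¬ Blocked E
  not-blocked cov F<pk (L , L-injective , broken) = ℕ.<⇒≱ F<pk (broken-lines-cost cov L L-injective broken)

  removed-edge-on-path : (e∈E : e ∈ E) → Passable E ℓ a → ¬ Passable (E ─ e∈E) ℓ a → ∃[ c ] e ∈ path ℓ a c
  removed-edge-on-path {e = e} e∈E (c , path⊆E) impassable with e ∈? path _ _ c
  ... | yes e∈path = c , e∈path
  ... | no e∉path  = ⊥-elim (impassable (c , ⊆-─ path⊆E e∈E e∉path))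

  cut-breaks-one-line : (e∈E : e ∈ E) → Intact E ℓ → Intact E ℓ′ →
                        Broken (E ─ e∈E) ℓ → Broken (E ─ e∈E) ℓ′ → ℓ ≡ ℓ′
  cut-breaks-one-line e∈E intact intact′ broken broken′ = cong proj₁ (paths-disjoint e∈path e∈path′)
    where
    e∈path = proj₂ (removed-edge-on-path e∈E (intact _) (proj₂ (impassable-segment broken)))
    e∈path′ = proj₂ (removed-edge-on-path e∈E (intact′ _) (proj₂ (impassable-segment broken′)))

  Crossing : Edges V → Line → Fin p → Set
  Crossing E ℓ t = Intact E ℓ × Intact E (perp ℓ t)

  CanMove : Edges V → V → Set
  CanMove E v = ∃₂ λ ℓ t → point ℓ t ≢ v × Reach E v (point ℓ t) × Crossing E ℓ t

  slide : Intact E ℓ → t′ ≢ t → Intact E (perp ℓ t′) → CanMove E (point ℓ t)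
  slide {ℓ = ℓ} {t′} {t} intact t′≢t intact′ =
    ℓ , t′ , t′≢t ∘ point-injective ℓ , intact-reach intact t t′ , intact , intact′

  intact-perp-elsewhere? : ∀ E ℓ t →
                           (∃[ t′ ] (t′ ≢ t × Intact E (perp ℓ t′))) ⊎ (∀ u → u ≢ t → Broken E (perp ℓ u))
  intact-perp-elsewhere? E ℓ t with any? (λ t′ → ¬? (t′ ≟ t) ×-dec intact? E (perp ℓ t′))
  ... | yes found = inj₁ found
  ... | no none   = inj₂ λ u u≢t intact → none (u , u≢t , intact)

  perps-blocked : (∀ u → u ≢ t → Broken E (perp ℓ u)) → Broken E ℓ* →
                  (∀ u → perp ℓ u ≡ ℓ* → u ≡ t) → Blocked E
  perps-blocked {t} {E} {ℓ} {ℓ*} others broken* only-at-t = L , L-injective , L-broken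
    where
    L : Fin p → Line
    L u with u ≟ t
    ... | yes _ = ℓ*
    ... | no _  = perp ℓ u

    L-broken : ∀ u → Broken E (L u)
    L-broken u with u ≟ t
    ... | yes _   = broken*
    ... | no u≢t = others u u≢t

    L-injective : Injective _≡_ _≡_ L
    L-injective {u} {u′} eq with u ≟ t | u′ ≟ t
    ... | yes refl | yes refl = refl
    ... | yes refl | no _     = sym (only-at-t u′ (sym eq))
    ... | no _     | yes refl = only-at-t u eq
    ... | no _     | no _     = perp-injective ℓ eq

  escape : ¬ Blocked E → Intact E ℓ → CanMove E (point ℓ t)
  escape {E} {ℓ} {t} unblocked intact with intact-perp-elsewhere? E ℓ t
  ... | inj₁ (t′ , t′≢t , intact′) = slide intact t′≢t intact′
  ... | inj₂ others with intact? E (perp ℓ t)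
  ...   | no broken = ⊥-elim (unblocked (perps-blocked others broken λ _ → perp-injective ℓ))
  ...   | yes intact⊥ with intact-perp-elsewhere? E (perp ℓ t) (position ℓ)
  ...     | inj₁ (n , n≢ℓ , intact″) = subst (CanMove E) (point-perp ℓ t) (slide intact⊥ n≢ℓ intact″)
  -- All lines but ℓ and perp ℓ t are broken; the other perpendiculars and one parallel of ℓ are p of them.
  ...     | inj₂ others′ =
    ⊥-elim (unblocked (perps-blocked others (others′ _ (punchInᵢ≢i (position ℓ) zero))
                                     λ u → ⊥-elim ∘ perp≢perp∘perp ℓ t u _))

  respond : (e∈E : e ∈ E) → ¬ Blocked (E ─ e∈E) → Crossing E ℓ t → CanMove (E ─ e∈E) (point ℓ t)
  respond {E = E} {ℓ = ℓ} {t} e∈E unblocked (intact , intact⊥)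
    with intact? (E ─ e∈E) ℓ | intact? (E ─ e∈E) (perp ℓ t)
  ... | yes intact′ | _            = escape unblocked intact′
  ... | no _        | yes intact⊥′ = subst (CanMove _) (point-perp ℓ t) (escape unblocked intact⊥′)
  ... | no broken   | no broken⊥   =
    ⊥-elim (perp≢ ℓ t (sym (cut-breaks-one-line e∈E intact intact⊥ broken broken⊥)))

  mutual
    cat-forces : ∀ s → Covering E F → length F + s ≤ p * k → Crossing E ℓ t → CatForcesH E (point ℓ t) s
    cat-forces zero    _   _      _        = h-zero
    cat-forces (suc s) cov budget crossing =
      h-suc (intact-incident (proj₁ crossing) _) (cat-reply s cov budget crossing)

    cat-reply : ∀ s → Covering E F → length F + suc s ≤ p * k → Crossing E ℓ t →
                (e∈E : e ∈ E) → CatForcesC (E ─ e∈E) (point ℓ t) s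
    cat-reply zero    _   _      _        _   = c-zero
    cat-reply {F = F} (suc s) cov budget crossing e∈E =
      let cov′ = covering-─ cov e∈E
          budget′ = subst (_≤ p * k) (ℕ.+-suc (length F) (suc s)) budget
          _ , _ , moved , route , crossing′ =
            respond e∈E (not-blocked cov′ (ℕ.<-≤-trans (ℕ.m<m+n _ z<s) budget′)) crossing
      in c-move _ moved route (cat-forces (suc s) cov′ budget′ crossing′)

  cat-Gr≥kp : 1 ≤ k → CatAtLeast V G (k * p)
  cat-Gr≥kp k≥1 =
    point (row zero) zero ,
    cat-forces {ℓ = row zero} {t = zero} (k * p) nothing-cut (ℕ.≤-reflexive (ℕ.*-comm k p))
               (intact-G _ , intact-G _)
    where
    nothing-cut : Covering G []
    nothing-cut = ∈-++⁺ˡ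

    intact-G : ∀ ℓ → Intact G ℓ
    intact-G ℓ a = fromℕ< k≥1 , path⊆G ℓ a (fromℕ< k≥1)

mainTheorem7 : (k p : ℕ) → 1 ≤ k → 3 ≤ p → CatAtLeast (GrV p k) (GrE p k) (k * p)
mainTheorem7 k (suc (suc q)) k≥1 (s≤s (s≤s _)) = Herding.cat-Gr≥kp q k k≥1
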